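{- Let $\mathcal{A}=\{\sigma\in\mathrm{Aut}(\mathbb{F}_{q^2}^*):\sigma(x)=x\text{ for all }x\in\mathbb{F}_q^*\}$. Then $|\mathcal{A}|=2\varphi(q+1)$ if $q$ is odd and $|\mathcal{A}|=\varphi(q+1)$ if $q$ is even.
   Context: $q$ is a prime power, $\mathbb{F}_q\subset\mathbb{F}_{q^2}$ finite fields, $\mathbb{F}_{q^2}^*$ the (cyclic) multiplicative group, $\mathrm{Aut}$ denotes group automorphisms, and $\varphi$ is Euler's totient function. -}

module Defs where

open import Level using (0ℓ)
open import Algebra.Bundles using (CommutativeRing)
open import Data.Nat using (ℕ; suc; _≟_)
open import Data.Nat.GCD using (gcd)
open import Data.Fin using (Fin)
open import Data.List using (length; filter; map; upTo)
open import Data.Product using (Σ; _×_; _,_; proj₁)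
open import Relation.Nullary using (¬_)
open import Relation.Binary.Bundles using (Setoid)
open import Relation.Binary.PropositionalEquality as ≡ using (_≡_)
open import Function.Bundles using (Bijection)

φ : ℕ → ℕ
φ n = length (filter (λ k → gcd k n ≟ 1) (map suc (upTo n)))

HasCardinality : Setoid 0ℓ 0ℓ → ℕ → Set
HasCardinality S n = Bijection (≡.setoid (Fin n)) S

module _ (R : CommutativeRing 0ℓ 0ℓ) where
  open CommutativeRing R

  IsField : Set
  IsField = ¬ (1# ≈ 0#) × (∀ x → ¬ (x ≈ 0#) → Σ Carrier λ y → x * y ≈ 1#)

  record Subfield : Set₁ where
    field
      P      : Carrier → Set
      P-resp : ∀ {x y} → x ≈ y → P x → P y
      P-0    : P 0#
      P-1    : P 1#
      P-+    : ∀ {x y} → P x → P y → P (x + y)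
      P--    : ∀ {x} → P x → P (- x)
      P-*    : ∀ {x y} → P x → P y → P (x * y)
      P-inv  : ∀ {x y} → P x → x * y ≈ 1# → P y

  SubfieldSetoid : Subfield → Setoid 0ℓ 0ℓ
  SubfieldSetoid F = record
    { Carrier = Σ Carrier (Subfield.P F)
    ; _≈_ = λ a b → proj₁ a ≈ proj₁ b
    ; isEquivalence = record { refl = refl ; sym = sym ; trans = trans }
    }

  Units : Set
  Units = Σ Carrier (λ x → ¬ (x ≈ 0#))

  _≈u_ : Units → Units → Set
  a ≈u b = proj₁ a ≈ proj₁ b

  record FixingAut (F : Subfield) : Set where
    field
      σ     : Units → Units
      σ-cong : ∀ {a b} → a ≈u b → σ a ≈u σ b
      σ-hom : ∀ a b c → proj₁ c ≈ proj₁ a * proj₁ b →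
              proj₁ (σ c) ≈ proj₁ (σ a) * proj₁ (σ b)
      σ-inj : ∀ {a b} → σ a ≈u σ b → a ≈u b
      σ-surj : ∀ b → Σ Units λ a → σ a ≈u b
      σ-fix : ∀ a → Subfield.P F (proj₁ a) → σ a ≈u a

  FixingAutSetoid : Subfield → Setoid 0ℓ 0ℓ
  FixingAutSetoid F = record
    { Carrier = FixingAut F
    ; _≈_ = λ s t → ∀ a → FixingAut.σ s a ≈u FixingAut.σ t a
    ; isEquivalence = record
        { refl = λ a → refl
        ; sym = λ e a → sym (e a)
        ; trans = λ e f a → trans (e a) (f a) }
    }

-- K* is cyclic of order N = q² - 1 = (q - 1)(q + 1): an element g of maximal order m exists, every
-- order divides m, and Xᵐ - 1 has at most m roots, so m = N. A group automorphism of K* is then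
-- x ↦ xᵃ with gcd (a, N) = 1, and it fixes F* pointwise iff it fixes g^(q+1) ∈ F*, i.e. iff a ≡ 1 (mod q - 1).
-- Writing a = 1 + (q - 1) t with t < q + 1, the automorphisms are counted by the t for which
-- 1 + (q - 1) t is prime to q + 1. For q even, t ↦ 1 + (q - 1) t permutes ℤ/(q + 1), giving φ (q + 1);
-- for q odd it has period (q + 1)/2 and runs twice through the odd residues, which include all units
-- of ℤ/(q + 1), giving 2 φ (q + 1). Notation: r = q - 1, L = q + 1, N = r L.
module Submission where

open import Level using (0ℓ)
open import Algebra.Bundles using (CommutativeRing)
open import Data.Nat.Base using (ℕ; suc; _<_)
open import Defs

module Arithmetic where

  open import Data.Empty using (⊥-elim)
  open import Data.List.Base using ([]; _∷_)
  open import Data.List.Relation.Unary.All using (_∷_)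
  open import Data.Nat.Base
  open import Data.Nat.Coprimality using (Coprime; coprime-divisor; coprime⇒gcd≡1)
  import Data.Nat.Coprimality as Coprime
  open import Data.Nat.DivMod using (_/_; _%_; m≡m%n+[m/n]*n)
  open import Data.Nat.Divisibility
  open import Data.Nat.GCD using (gcd)
  open import Data.Nat.Induction using (<-rec)
  open import Data.Nat.LCM using (lcm; lcm-least; gcd*lcm)
  open import Data.Nat.ListAction using (product)
  open import Data.Nat.Primality using (Prime; prime⇒irreducible; prime⇒nonTrivial)
  open import Data.Nat.Primality.Factorisation using (factorise)
  open import Data.Nat.Properties
  open import Data.Product.Base using (Σ; _×_; _,_)
  open import Data.Sum.Base using (_⊎_; inj₁; inj₂; [_,_]′)
  open import Relation.Binary.PropositionalEquality
  open import Relation.Nullary using (¬_; yes; no)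
  open import Relation.Unary using (Decidable)

  least : ∀ {P : ℕ → Set} → Decidable P → ∀ {d} → P d → Σ ℕ λ m → P m × (∀ {k} → k < m → ¬ P k)
  least {P} P? {d} pd with search (suc d)
    where
    search : ∀ n → (Σ ℕ λ m → P m × (∀ {k} → k < m → ¬ P k)) ⊎ (∀ {k} → k < n → ¬ P k)
    search zero    = inj₂ λ ()
    search (suc n) with search n
    ... | inj₁ found = inj₁ found
    ... | inj₂ none with P? n
    ...   | yes pn = inj₁ (n , pn , none)
    ...   | no ¬pn = inj₂ λ k<1+n → [ none , (λ { refl → ¬pn }) ]′ (m≤n⇒m<n∨m≡n (s≤s⁻¹ k<1+n))
  ... | inj₁ found = found
  ... | inj₂ none  = ⊥-elim (none ≤-refl pd)

  ∣∧<⇒≡0 : ∀ {m a} → m ∣ a → a < m → a ≡ 0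
  ∣∧<⇒≡0 {a = zero}  _   _   = refl
  ∣∧<⇒≡0 {a = suc a} m∣a a<m = ⊥-elim (<⇒≱ a<m (∣⇒≤ m∣a))

  ∣∸∧<⇒≡ : ∀ {m t t′} → t ≤ t′ → t′ < m → m ∣ t′ ∸ t → t ≡ t′
  ∣∸∧<⇒≡ {t = t} {t′} t≤t′ t′<m m∣t′∸t =
    ≤-antisym t≤t′ (m∸n≡0⇒m≤n (∣∧<⇒≡0 m∣t′∸t (≤-<-trans (m∸n≤m t′ t) t′<m)))

  %-≡⇒∣∸ : ∀ {a b} n .{{_ : NonZero n}} → a ≤ b → a % n ≡ b % n → n ∣ b ∸ a
  %-≡⇒∣∸ {a} {b} n a≤b eq = divides (b / n ∸ a / n) (begin
    b ∸ a                                     ≡⟨ cong₂ _∸_ (m≡m%n+[m/n]*n b n) (m≡m%n+[m/n]*n a n) ⟩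
    (b % n + b / n * n) ∸ (a % n + a / n * n) ≡⟨ cong (λ x → (b % n + b / n * n) ∸ (x + a / n * n)) eq ⟩
    (b % n + b / n * n) ∸ (b % n + a / n * n) ≡⟨ [m+n]∸[m+o]≡n∸o (b % n) _ _ ⟩
    b / n * n ∸ a / n * n                     ≡⟨ *-distribʳ-∸ n (b / n) (a / n) ⟨
    (b / n ∸ a / n) * n                       ∎)
    where open ≡-Reasoning

  m^n∣m^o : ∀ m {n o} → n ≤ o → m ^ n ∣ m ^ o
  m^n∣m^o m {n} {o} n≤o = divides (m ^ (o ∸ n)) (begin
    m ^ o               ≡⟨ cong (m ^_) (m+[n∸m]≡n n≤o) ⟨
    m ^ (n + (o ∸ n))   ≡⟨ ^-distribˡ-+-* m n (o ∸ n) ⟩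
    m ^ n * m ^ (o ∸ n) ≡⟨ *-comm (m ^ n) _ ⟩
    m ^ (o ∸ n) * m ^ n ∎)
    where open ≡-Reasoning

  coprime-*ˡ : ∀ {a b x} → Coprime a x → Coprime b x → Coprime (a * b) x
  coprime-*ˡ a⊥x b⊥x (d∣ab , d∣x) =
    b⊥x (coprime-divisor (λ (e∣d , e∣a) → a⊥x (e∣a , ∣-trans e∣d d∣x)) d∣ab , d∣x)

  coprime-^ˡ : ∀ {a x} → Coprime a x → ∀ k → Coprime (a ^ k) x
  coprime-^ˡ a⊥x zero    (d∣1 , _) = ∣1⇒≡1 d∣1
  coprime-^ˡ a⊥x (suc k) = coprime-*ˡ a⊥x (coprime-^ˡ a⊥x k)

  coprime-∣⇒*∣ : ∀ {a b m} → Coprime a b → a ∣ m → b ∣ m → a * b ∣ m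
  coprime-∣⇒*∣ {a} {b} {m} a⊥b a∣m b∣m = subst (_∣ m) lcm≡a*b (lcm-least a∣m b∣m)
    where
    open ≡-Reasoning
    lcm≡a*b : lcm a b ≡ a * b
    lcm≡a*b = begin
      lcm a b           ≡⟨ +-identityʳ (lcm a b) ⟨
      1 * lcm a b       ≡⟨ cong (_* lcm a b) (coprime⇒gcd≡1 a⊥b) ⟨
      gcd a b * lcm a b ≡⟨ gcd*lcm a b ⟩
      a * b             ∎

  prime∤⇒coprime : ∀ {p x} → Prime p → ¬ p ∣ x → Coprime p x
  prime∤⇒coprime pp p∤x (d∣p , d∣x) with prime⇒irreducible pp d∣p
  ... | inj₁ d≡1  = d≡1
  ... | inj₂ refl = ⊥-elim (p∤x d∣x)

  prime-factor : ∀ n → 1 < n → Σ ℕ λ p → Prime p × p ∣ n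
  prime-factor n@(suc _) 1<n with factorise n
  ... | record { factors = []     ; isFactorisation = n≡1 } = ⊥-elim (<⇒≢ 1<n (sym n≡1))
  ... | record { factors = p ∷ ps ; isFactorisation = n≡p*ps ; factorsPrime = pp ∷ _ } =
    p , pp , divides (product ps) (trans n≡p*ps (*-comm p (product ps)))

  prime-power-split : ∀ {p} → Prime p → ∀ n → 0 < n →
                      Σ ℕ λ k → Σ ℕ λ n₀ → n ≡ p ^ k * n₀ × ¬ p ∣ n₀
  prime-power-split {p} pp = <-rec _ split
    where
    1<p : 1 < p
    1<p = nonTrivial⇒n>1 p {{prime⇒nonTrivial pp}}
    split : ∀ n → (∀ {m} → m < n → 0 < m → Σ ℕ λ k → Σ ℕ λ n₀ → m ≡ p ^ k * n₀ × ¬ p ∣ n₀) →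
            0 < n → Σ ℕ λ k → Σ ℕ λ n₀ → n ≡ p ^ k * n₀ × ¬ p ∣ n₀
    split n rec 0<n with p ∣? n
    ... | no p∤n = 0 , n , sym (+-identityʳ n) , p∤n
    ... | yes (divides zero      n≡0)   = ⊥-elim (<⇒≢ 0<n (sym n≡0))
    ... | yes (divides m@(suc _) n≡m*p) with rec (subst (m <_) (sym n≡m*p) (m<m*n m p 1<p)) z<s
    ...   | k , n₀ , m≡pᵏn₀ , p∤n₀ = suc k , n₀ , n≡pᵏ⁺¹n₀ , p∤n₀
      where
      n≡pᵏ⁺¹n₀ : n ≡ p * p ^ k * n₀
      n≡pᵏ⁺¹n₀ = begin
        n                ≡⟨ n≡m*p ⟩
        m * p            ≡⟨ cong (_* p) m≡pᵏn₀ ⟩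
        p ^ k * n₀ * p   ≡⟨ *-comm (p ^ k * n₀) p ⟩
        p * (p ^ k * n₀) ≡⟨ *-assoc p (p ^ k) n₀ ⟨
        p * p ^ k * n₀   ∎
        where open ≡-Reasoning

  ¬coprime-0 : ∀ {n} → 1 < n → ¬ Coprime 0 n
  ¬coprime-0 1<n 0⊥n = <⇒≢ 1<n (sym (0⊥n (divides 0 refl , ∣-refl)))

  ¬coprime-self : ∀ {n} → 1 < n → ¬ Coprime n n
  ¬coprime-self 1<n n⊥n = <⇒≢ 1<n (sym (n⊥n (∣-refl , ∣-refl)))

  coprime-∣ʳ : ∀ {x n m} → Coprime x n → m ∣ n → Coprime x m
  coprime-∣ʳ x⊥n m∣n (d∣x , d∣m) = x⊥n (d∣x , ∣-trans d∣m m∣n)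

  coprime-*ʳ : ∀ {x a b} → Coprime x a → Coprime x b → Coprime x (a * b)
  coprime-*ʳ x⊥a x⊥b = Coprime.sym (coprime-*ˡ (Coprime.sym x⊥a) (Coprime.sym x⊥b))

  coprime⇒coprime-% : ∀ x n .{{_ : NonZero n}} → Coprime x n → Coprime (x % n) n
  coprime⇒coprime-% x n x⊥n (d∣x%n , d∣n) = x⊥n (∣n∣m%n⇒∣m d∣n d∣x%n , d∣n)

  coprime-%⇒coprime : ∀ x n .{{_ : NonZero n}} → Coprime (x % n) n → Coprime x n
  coprime-%⇒coprime x n x%n⊥n (d∣x , d∣n) = x%n⊥n (%-presˡ-∣ d∣x d∣n , d∣n)

module Counting where

  open import Data.Bool.Base using (if_then_else_)
  open import Data.Empty using (⊥-elim)
  open import Data.Fin.Base using (Fin; zero; suc)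
  import Data.Fin.Properties as Fin
  open import Data.List.Base using (List; []; _∷_; length; filter; applyUpTo; _++_)
  import Data.List.Properties as List
  open import Data.Nat.Base
  open import Data.Nat.Properties
  open import Data.Product.Base using (Σ; _×_; _,_; proj₁; proj₂)
  open import Data.Sum.Base using (inj₁; inj₂)
  open import Function.Base using (id; _∘_)
  open import Function.Definitions using (Injective)
  open import Relation.Binary.PropositionalEquality
  open import Relation.Nullary using (¬_; yes; no; does; ¬?)
  open import Relation.Unary using (Decidable)

  module _ {P : ℕ → Set} (P? : Decidable P) where

    count : ℕ → ℕ
    count zero    = 0
    count (suc n) = if does (P? n) then suc (count n) else count n

    nth : ∀ n → Fin (count n) → ℕ
    nth (suc n) i with P? n
    nth (suc n) zero    | yes _ = n
    nth (suc n) (suc i) | yes _ = nth n i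
    nth (suc n) i       | no _  = nth n i

    nth-< : ∀ n i → nth n i < n
    nth-< (suc n) i with P? n
    nth-< (suc n) zero    | yes _ = ≤-refl
    nth-< (suc n) (suc i) | yes _ = m≤n⇒m≤1+n (nth-< n i)
    nth-< (suc n) i       | no _  = m≤n⇒m≤1+n (nth-< n i)

    nth-satisfies : ∀ n i → P (nth n i)
    nth-satisfies (suc n) i with P? n
    nth-satisfies (suc n) zero    | yes p = p
    nth-satisfies (suc n) (suc i) | yes _ = nth-satisfies n i
    nth-satisfies (suc n) i       | no _  = nth-satisfies n i

    nth-injective : ∀ n {i j} → nth n i ≡ nth n j → i ≡ j
    nth-injective (suc n) eq with P? n
    nth-injective (suc n) {zero}  {zero}  eq | yes _ = refl
    nth-injective (suc n) {zero}  {suc j} eq | yes _ = ⊥-elim (<-irrefl (sym eq) (nth-< n j))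
    nth-injective (suc n) {suc i} {zero}  eq | yes _ = ⊥-elim (<-irrefl eq (nth-< n i))
    nth-injective (suc n) {suc i} {suc j} eq | yes _ = cong suc (nth-injective n eq)
    nth-injective (suc n) {i}     {j}     eq | no _  = nth-injective n eq

    nth-surjective : ∀ n {k} → k < n → P k → Σ (Fin (count n)) λ i → nth n i ≡ k
    nth-surjective (suc n) k<1+n pk with P? n | m≤n⇒m<n∨m≡n (s≤s⁻¹ k<1+n)
    ... | yes _ | inj₂ refl = zero , refl
    ... | yes _ | inj₁ k<n  = let i , eq = nth-surjective n k<n pk in suc i , eq
    ... | no ¬p | inj₂ refl = ⊥-elim (¬p pk)
    ... | no _  | inj₁ k<n  = nth-surjective n k<n pk

    count-suc-no : ∀ {n} → ¬ P n → count (suc n) ≡ count n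
    count-suc-no {n} ¬p with P? n
    ... | yes p = ⊥-elim (¬p p)
    ... | no _  = refl

    count-none : ∀ n → (∀ {k} → k < n → ¬ P k) → count n ≡ 0
    count-none zero    _    = refl
    count-none (suc n) none with P? n
    ... | yes p = ⊥-elim (none ≤-refl p)
    ... | no _  = count-none n (none ∘ m≤n⇒m≤1+n)

  count-complement : ∀ {P : ℕ → Set} (P? : Decidable P) n → count P? n + count (¬? ∘ P?) n ≡ n
  count-complement P? zero    = refl
  count-complement P? (suc n) with P? n
  ... | yes _ = cong suc (count-complement P? n)
  ... | no _  = trans (+-suc _ _) (cong suc (count-complement P? n))

  count-≤-injection : ∀ {P Q : ℕ → Set} (P? : Decidable P) (Q? : Decidable Q) {n m} (f : ℕ → ℕ) →
    (∀ {k} → k < n → P k → f k < m × Q (f k)) →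
    (∀ {k k′} → k ≤ k′ → k′ < n → f k ≡ f k′ → k ≡ k′) →
    count P? n ≤ count Q? m
  count-≤-injection {P} {Q} P? Q? {n} {m} f maps f-injective = Fin.injective⇒≤ image-injective
    where
    image : ∀ i → Σ (Fin (count Q? m)) λ j → nth Q? m j ≡ f (nth P? n i)
    image i = let f< , q = maps (nth-< P? n i) (nth-satisfies P? n i) in nth-surjective Q? m f< q
    f-injective′ : ∀ {k k′} → k < n → k′ < n → f k ≡ f k′ → k ≡ k′
    f-injective′ {k} {k′} k<n k′<n eq with ≤-total k k′
    ... | inj₁ k≤k′ = f-injective k≤k′ k′<n eq
    ... | inj₂ k′≤k = sym (f-injective k′≤k k<n (sym eq))
    image-injective : ∀ {i j} → proj₁ (image i) ≡ proj₁ (image j) → i ≡ j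
    image-injective {i} {j} eq = nth-injective P? n (f-injective′ (nth-< P? n i) (nth-< P? n j)
      (trans (sym (proj₂ (image i))) (trans (cong (nth Q? m) eq) (proj₂ (image j)))))

  module _ {P Q : ℕ → Set} (P? : Decidable P) (Q? : Decidable Q) where

    -- no inverse of u is needed: comparing the complements as well gives the reverse inequality
    count-≡-injection : ∀ {n} (u : ℕ → ℕ) → (∀ {t} → t < n → u t < n) →
      (∀ {t t′} → t ≤ t′ → t′ < n → u t ≡ u t′ → t ≡ t′) →
      (∀ {t} → t < n → P t → Q (u t)) → (∀ {t} → t < n → Q (u t) → P t) →
      count P? n ≡ count Q? n
    count-≡-injection {n} u u< u-injective P⇒Q Q⇒P = ≤-antisym P≤Q (+-cancelʳ-≤ _ _ _ Q+Q̅≤P+Q̅)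
      where
      P≤Q : count P? n ≤ count Q? n
      P≤Q = count-≤-injection P? Q? u (λ t<n p → u< t<n , P⇒Q t<n p) u-injective
      P̅≤Q̅ : count (¬? ∘ P?) n ≤ count (¬? ∘ Q?) n
      P̅≤Q̅ = count-≤-injection (¬? ∘ P?) (¬? ∘ Q?) u (λ t<n ¬p → u< t<n , ¬p ∘ Q⇒P t<n) u-injective
      Q+Q̅≤P+Q̅ : count Q? n + count (¬? ∘ Q?) n ≤ count P? n + count (¬? ∘ Q?) n
      Q+Q̅≤P+Q̅ = begin
        count Q? n + count (¬? ∘ Q?) n ≡⟨ count-complement Q? n ⟩
        n                              ≡⟨ count-complement P? n ⟨
        count P? n + count (¬? ∘ P?) n ≤⟨ +-monoʳ-≤ (count P? n) P̅≤Q̅ ⟩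
        count P? n + count (¬? ∘ Q?) n ∎
        where open ≤-Reasoning

    count-cong : ∀ {n} → (∀ {k} → k < n → P k → Q k) → (∀ {k} → k < n → Q k → P k) → count P? n ≡ count Q? n
    count-cong P⇒Q Q⇒P = count-≡-injection id id (λ t≤t′ _ → id) P⇒Q Q⇒P

  module _ {P : ℕ → Set} (P? : Decidable P) where

    count-+ : ∀ a b → count P? (a + b) ≡ count P? a + count (P? ∘ (a +_)) b
    count-+ a zero    = trans (cong (count P?) (+-identityʳ a)) (sym (+-identityʳ _))
    count-+ a (suc b) rewrite +-suc a b with P? (a + b)
    ... | yes _ = trans (cong suc (count-+ a b)) (sym (+-suc _ _))
    ... | no _  = count-+ a b

    count-even+odd : ∀ M → count P? (M + M) ≡ count (λ v → P? (v + v)) M + count (λ v → P? (suc (v + v))) M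
    count-even+odd zero    = refl
    count-even+odd (suc M) rewrite +-suc M M with P? (M + M) | P? (suc (M + M))
    ... | yes _ | yes _ = cong suc (trans (cong suc (count-even+odd M)) (sym (+-suc _ _)))
    ... | yes _ | no _  = cong suc (count-even+odd M)
    ... | no _  | yes _ = trans (cong suc (count-even+odd M)) (sym (+-suc _ _))
    ... | no _  | no _  = count-even+odd M

    length-filter-applyUpTo : ∀ (f : ℕ → ℕ) n → length (filter P? (applyUpTo f n)) ≡ count (P? ∘ f) n
    length-filter-applyUpTo f zero    = refl
    length-filter-applyUpTo f (suc n) = begin
      length (filter P? (applyUpTo f (suc n)))   ≡⟨ cong (length ∘ filter P?) (List.applyUpTo-∷ʳ f n) ⟨
      length (filter P? (xs ++ f n ∷ []))         ≡⟨ cong length (List.filter-++ P? xs (f n ∷ [])) ⟩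
      length (filter P? xs ++ filter P? (f n ∷ [])) ≡⟨ List.length-++ (filter P? xs) ⟩
      length (filter P? xs) + last                ≡⟨ cong (_+ last) (length-filter-applyUpTo f n) ⟩
      count (P? ∘ f) n + last                     ≡⟨ add-last ⟩
      count (P? ∘ f) (suc n)                      ∎
      where
      open ≡-Reasoning
      xs : List ℕ
      xs = applyUpTo f n
      last : ℕ
      last = length (filter P? (f n ∷ []))
      add-last : count (P? ∘ f) n + last ≡ count (P? ∘ f) (suc n)
      add-last with P? (f n)
      ... | yes _ = +-comm _ 1
      ... | no _  = +-identityʳ _

  argmax : ∀ {n} (f : Fin (suc n) → ℕ) → Σ (Fin (suc n)) λ j → ∀ i → f i ≤ f j
  argmax {zero}  f = zero , λ { zero → ≤-refl }
  argmax {suc n} f with argmax (f ∘ suc)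
  ... | j , max with f zero ≤? f (suc j)
  ...   | yes f₀≤ = suc j , λ { zero → f₀≤ ; (suc i) → max i }
  ...   | no  f₀≰ = zero  , λ { zero → ≤-refl ; (suc i) → ≤-trans (max i) (<⇒≤ (≰⇒> f₀≰)) }

  injective⇒surjective : ∀ {n} {f : Fin n → Fin n} → Injective _≡_ _≡_ f → ∀ y → Σ (Fin n) λ i → f i ≡ y
  injective⇒surjective {suc n} {f} f-injective y with Fin.any? (λ i → f i Fin.≟ y)
  ... | yes hit = hit
  ... | no miss = ⊥-elim (<-irrefl refl (Fin.injective⇒≤ (f-injective ∘ Fin.punchOut-injective (avoid _) (avoid _))))
    where
    -- missing y, f would inject Fin (suc n) into Fin n
    avoid : ∀ i → y ≢ f i
    avoid i y≡fi = miss (i , sym y≡fi)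

module Totient where

  open import Data.List.Base using (length; filter; applyUpTo)
  import Data.List.Properties as List
  open import Data.Nat.Base
  open import Data.Nat.Coprimality using (Coprime; coprime?; coprime-+; coprime-divisor; gcd≡1⇒coprime; coprime⇒gcd≡1)
  open import Data.Nat.DivMod
  open import Data.Nat.Divisibility
  open import Data.Nat.GCD using (gcd)
  open import Data.Nat.Primality using (prime[2])
  open import Data.Nat.Properties
  open import Data.Nat.Solver using (module +-*-Solver)
  open import Data.Product.Base using (_,_)
  open import Function.Base using (id; _∘_)
  open import Relation.Binary.PropositionalEquality
  open import Relation.Nullary using (¬_; Dec; contradiction)
  open Arithmetic
  open Counting
  open +-*-Solver

  φ≡count-coprime : ∀ n → 1 < n → φ n ≡ count (λ k → coprime? k n) n
  φ≡count-coprime n 1<n = begin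
    φ n                                  ≡⟨ cong (length ∘ filter G?) (List.map-applyUpTo id suc n) ⟩
    length (filter G? (applyUpTo suc n)) ≡⟨ length-filter-applyUpTo G? suc n ⟩
    count (G? ∘ suc) n                   ≡⟨ count-cong (G? ∘ suc) (C? ∘ suc) {n}
                                              (λ _ → gcd≡1⇒coprime) (λ _ → coprime⇒gcd≡1) ⟩
    count (C? ∘ suc) n                   ≡⟨ trans (count-+ C? 1 n) (cong (_+ count (C? ∘ suc) n) 0∉) ⟨
    count C? (suc n)                     ≡⟨ count-suc-no C? (¬coprime-self 1<n) ⟩
    count C? n                           ∎
    where
    open ≡-Reasoning
    G? : ∀ k → Dec (gcd k n ≡ 1)
    G? k = gcd k n ≟ 1
    C? : ∀ k → Dec (Coprime k n)
    C? k = coprime? k n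
    0∉ : count C? 1 ≡ 0
    0∉ = count-none C? 1 λ { (s≤s z≤n) → ¬coprime-0 1<n }

  module UnitExponents (r : ℕ) where

    L : ℕ
    L = suc r + 1

    N : ℕ
    N = r * L

    IsUnitExponent : ℕ → Set
    IsUnitExponent t = Coprime (1 + r * t) N

    unitExponent? : ∀ t → Dec (IsUnitExponent t)
    unitExponent? t = coprime? (1 + r * t) N

    1<L : 1 < L
    1<L = s≤s (m≤n+m 1 r)

    residue : ℕ → ℕ
    residue t = (1 + r * t) % L

    residue-< : ∀ t → residue t < L
    residue-< t = m%n<n (1 + r * t) L

    1+rt⊥r : ∀ t → Coprime (1 + r * t) r
    1+rt⊥r t {d} (d∣1+rt , d∣r) =
      ∣1⇒≡1 (∣m+n∣m⇒∣n (subst (d ∣_) (+-comm 1 (r * t)) d∣1+rt) (∣m⇒∣m*n t d∣r))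

    unitExponent⇒coprime-residue : ∀ {t} → IsUnitExponent t → Coprime (residue t) L
    unitExponent⇒coprime-residue {t} a⊥N = coprime⇒coprime-% (1 + r * t) L (coprime-∣ʳ a⊥N (n∣m*n r))

    coprime-residue⇒unitExponent : ∀ {t} → Coprime (residue t) L → IsUnitExponent t
    coprime-residue⇒unitExponent {t} = coprime-*ʳ (1+rt⊥r t) ∘ coprime-%⇒coprime (1 + r * t) L

    unitExponent-resp-residue : ∀ {t t′} → residue t ≡ residue t′ → IsUnitExponent t → IsUnitExponent t′
    unitExponent-resp-residue same =
      coprime-residue⇒unitExponent ∘ subst (λ x → Coprime x L) same ∘ unitExponent⇒coprime-residue

    residue-≡⇒∣ : ∀ {t t′} → t ≤ t′ → residue t ≡ residue t′ → L ∣ r * (t′ ∸ t)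
    residue-≡⇒∣ {t} {t′} t≤t′ eq =
      subst (L ∣_) (sym (*-distribˡ-∸ r t′ t)) (%-≡⇒∣∸ L (s≤s (*-monoʳ-≤ r t≤t′)) eq)

    -- when gcd (L, r) = 1, t ↦ 1 + r t is a bijection of ℤ/L
    count-unitExponents-coprime : Coprime L r → count unitExponent? L ≡ φ L
    count-unitExponents-coprime L⊥r = begin
      count unitExponent? L        ≡⟨ count-≡-injection unitExponent? (λ k → coprime? k L) residue (λ _ → residue-< _)
                                        residue-injective (λ _ → unitExponent⇒coprime-residue)
                                        (λ _ → coprime-residue⇒unitExponent) ⟩
      count (λ k → coprime? k L) L ≡⟨ φ≡count-coprime L 1<L ⟨
      φ L                          ∎
      where
      open ≡-Reasoning
      residue-injective : ∀ {t t′} → t ≤ t′ → t′ < L → residue t ≡ residue t′ → t ≡ t′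
      residue-injective t≤t′ t′<L eq = ∣∸∧<⇒≡ t≤t′ t′<L (coprime-divisor L⊥r (residue-≡⇒∣ t≤t′ eq))

  -- for r = 2h the residue 1 + r t (mod L = 2(h + 1)) is odd and has period h + 1 in t
  module UnitExponentsEven (h : ℕ) where
    open UnitExponents (h + h)

    M : ℕ
    M = suc h

    L≡M+M : L ≡ M + M
    L≡M+M = solve 1 (λ h → con 1 :+ (h :+ h) :+ con 1 := (con 1 :+ h) :+ (con 1 :+ h)) refl h

    L≡M*2 : L ≡ M * 2
    L≡M*2 = solve 1 (λ h → con 1 :+ (h :+ h) :+ con 1 := (con 1 :+ h) :* con 2) refl h

    residue-periodic : ∀ t → residue (M + t) ≡ residue t
    residue-periodic t = trans (cong (_% L) shift) ([m+kn]%n≡m%n (1 + (h + h) * t) h L)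
      where
      shift : 1 + (h + h) * (M + t) ≡ 1 + (h + h) * t + h * L
      shift = solve 2 (λ h t → con 1 :+ (h :+ h) :* ((con 1 :+ h) :+ t)
                            := con 1 :+ (h :+ h) :* t :+ h :* (con 1 :+ (h :+ h) :+ con 1)) refl h t

    residue-odd : ∀ t → residue t % 2 ≡ 1
    residue-odd t = begin
      (1 + (h + h) * t) % L % 2 ≡⟨ m∣n⇒o%n%m≡o%m 2 L (1 + (h + h) * t) (divides M L≡M*2) ⟩
      (1 + (h + h) * t) % 2     ≡⟨ cong (_% 2) (solve 2 (λ h t → con 1 :+ (h :+ h) :* t := con 1 :+ h :* t :* con 2)
                                                        refl h t) ⟩
      (1 + h * t * 2) % 2       ≡⟨ [m+kn]%n≡m%n 1 (h * t) 2 ⟩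
      1                         ∎
      where open ≡-Reasoning

    half : ℕ → ℕ
    half t = residue t / 2

    residue≡1+2*half : ∀ t → residue t ≡ suc (half t + half t)
    residue≡1+2*half t = trans (m≡m%n+[m/n]*n (residue t) 2)
      (cong₂ _+_ (residue-odd t) (solve 1 (λ x → x :* con 2 := x :+ x) refl (half t)))

    half-< : ∀ t → half t < M
    half-< t = m<n*o⇒m/o<n (subst (residue t <_) L≡M*2 (residue-< t))

    half-injective : ∀ {t t′} → t ≤ t′ → t′ < M → half t ≡ half t′ → t ≡ t′
    half-injective {t} {t′} t≤t′ t′<M eq =
      ∣∸∧<⇒≡ t≤t′ t′<M (coprime-divisor M⊥h (*-cancelʳ-∣ 2 (subst₂ _∣_ L≡M*2 r≡h*2 L∣r*d)))
      where
      d : ℕ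
      d = t′ ∸ t
      L∣r*d : L ∣ (h + h) * d
      L∣r*d = residue-≡⇒∣ t≤t′
        (trans (residue≡1+2*half t) (trans (cong (λ x → suc (x + x)) eq) (sym (residue≡1+2*half t′))))
      r≡h*2 : (h + h) * d ≡ h * d * 2
      r≡h*2 = solve 2 (λ h d → (h :+ h) :* d := h :* d :* con 2) refl h d
      M⊥h : Coprime M h
      M⊥h {e} (e∣M , e∣h) = ∣1⇒≡1 (∣m+n∣m⇒∣n (subst (e ∣_) (+-comm 1 h) e∣M) e∣h)

    OddCoprime? : ∀ v → Dec (Coprime (suc (v + v)) L)
    OddCoprime? v = coprime? (suc (v + v)) L

    φ≡count-odd-coprime : φ L ≡ count OddCoprime? M
    φ≡count-odd-coprime = begin
      φ L                                       ≡⟨ φ≡count-coprime L 1<L ⟩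
      count C? L                                ≡⟨ cong (count C?) L≡M+M ⟩
      count C? (M + M)                          ≡⟨ count-even+odd C? M ⟩
      count EvenCoprime? M + count OddCoprime? M ≡⟨ cong (_+ count OddCoprime? M) no-even ⟩
      count OddCoprime? M                       ∎
      where
      open ≡-Reasoning
      C? : ∀ k → Dec (Coprime k L)
      C? k = coprime? k L
      EvenCoprime? : ∀ v → Dec (Coprime (v + v) L)
      EvenCoprime? v = C? (v + v)
      no-even : count EvenCoprime? M ≡ 0
      no-even = count-none EvenCoprime? M λ {v} _ v+v⊥L →
        contradiction (v+v⊥L (divides v (solve 1 (λ v → v :+ v := v :* con 2) refl v) , divides M L≡M*2)) λ ()

    count-unitExponents-periodic : count unitExponent? L ≡ count unitExponent? M + count unitExponent? M
    count-unitExponents-periodic = begin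
      count unitExponent? L                                    ≡⟨ cong (count unitExponent?) L≡M+M ⟩
      count unitExponent? (M + M)                              ≡⟨ count-+ unitExponent? M M ⟩
      count unitExponent? M + count (unitExponent? ∘ (M +_)) M ≡⟨ cong (count unitExponent? M +_) shifted ⟩
      count unitExponent? M + count unitExponent? M            ∎
      where
      open ≡-Reasoning
      shifted : count (unitExponent? ∘ (M +_)) M ≡ count unitExponent? M
      shifted = count-cong (unitExponent? ∘ (M +_)) unitExponent? {M}
        (λ {t} _ → unitExponent-resp-residue (residue-periodic t))
        (λ {t} _ → unitExponent-resp-residue (sym (residue-periodic t)))

    count-unitExponents-even : count unitExponent? L ≡ 2 * φ L
    count-unitExponents-even = begin
      count unitExponent? L                         ≡⟨ count-unitExponents-periodic ⟩
      count unitExponent? M + count unitExponent? M ≡⟨ cong₂ _+_ half-count half-count ⟩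
      φ L + φ L                                     ≡⟨ cong (φ L +_) (+-identityʳ (φ L)) ⟨
      2 * φ L                                       ∎
      where
      open ≡-Reasoning
      half-count : count unitExponent? M ≡ φ L
      half-count = trans
        (count-≡-injection unitExponent? OddCoprime? half (λ {t} _ → half-< t) half-injective
          (λ {t} _ → subst (λ x → Coprime x L) (residue≡1+2*half t) ∘ unitExponent⇒coprime-residue)
          (λ {t} _ → coprime-residue⇒unitExponent ∘ subst (λ x → Coprime x L) (sym (residue≡1+2*half t))))
        (sym φ≡count-odd-coprime)

  open UnitExponents using (unitExponent?)

  count-unitExponents-q-even : ∀ r → suc r % 2 ≡ 0 → count (unitExponent? r) (suc r + 1) ≡ φ (suc r + 1)
  count-unitExponents-q-even r q-even = UnitExponents.count-unitExponents-coprime r L⊥r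
    where
    2∤r : ¬ 2 ∣ r
    2∤r 2∣r = contradiction (∣1⇒≡1 (∣m+n∣m⇒∣n (subst (2 ∣_) (+-comm 1 r) (m%n≡0⇒n∣m (suc r) 2 q-even)) 2∣r))
                            λ ()
    L⊥r : Coprime (suc r + 1) r
    L⊥r = subst (λ L → Coprime L r) (solve 1 (λ r → r :+ con 2 := con 1 :+ r :+ con 1) refl r)
            (coprime-+ (prime∤⇒coprime prime[2] 2∤r))

  count-unitExponents-q-odd : ∀ r → suc r % 2 ≡ 1 → count (unitExponent? r) (suc r + 1) ≡ 2 * φ (suc r + 1)
  count-unitExponents-q-odd r q-odd = subst (λ r → count (unitExponent? r) (suc r + 1) ≡ 2 * φ (suc r + 1))
    (sym r≡h+h) (UnitExponentsEven.count-unitExponents-even h)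
    where
    h : ℕ
    h = suc r / 2
    r≡h+h : r ≡ h + h
    r≡h+h = suc-injective (trans (m≡m%n+[m/n]*n (suc r) 2) (cong₂ _+_ q-odd (solve 1 (λ h → h :* con 2 := h :+ h) refl h)))

module FieldRoots (K : CommutativeRing 0ℓ 0ℓ) (isField : IsField K) where

  open import Data.Empty using (⊥-elim)
  open import Data.Fin.Base using (Fin; zero; suc)
  open import Data.Fin.Properties using (suc-injective)
  open import Data.Nat.Base using (zero; suc; _≤_; _<_; z≤n; s≤s)
  open import Data.Product.Base using (Σ; _,_; proj₁; proj₂)
  open import Data.Vec.Base using (Vec; []; _∷_; replicate)
  open import Function.Base using (_∘_)
  open import Function.Definitions using (Injective)
  open import Relation.Binary.PropositionalEquality using (_≡_)
  open import Relation.Nullary using (¬_)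

  open CommutativeRing K hiding (zero)
  open import Algebra.Properties.CommutativeSemiring.Exp commutativeSemiring public
  import Algebra.Properties.Group +-group as +-Group
  open import Algebra.Solver.Ring.NaturalCoefficients.Default commutativeSemiring
  open import Relation.Binary.Reasoning.Setoid setoid

  Nonzero : Carrier → Set
  Nonzero x = ¬ (x ≈ 0#)

  1≉0 : Nonzero 1#
  1≉0 = proj₁ isField

  _⁻¹ : ∀ x → Nonzero x → Carrier
  (x ⁻¹) x≉0 = proj₁ (proj₂ isField x x≉0)

  *-inverseʳ : ∀ x (x≉0 : Nonzero x) → x * (x ⁻¹) x≉0 ≈ 1#
  *-inverseʳ x x≉0 = proj₂ (proj₂ isField x x≉0)

  *-cancelˡ : ∀ {x y z} → Nonzero x → x * y ≈ x * z → y ≈ z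
  *-cancelˡ {x} {y} {z} x≉0 eq = begin
    y                 ≈⟨ *-identityˡ y ⟨
    1# * y            ≈⟨ *-congʳ x⁻¹x≈1 ⟨
    x⁻¹ * x * y       ≈⟨ *-assoc x⁻¹ x y ⟩
    x⁻¹ * (x * y)     ≈⟨ *-congˡ eq ⟩
    x⁻¹ * (x * z)     ≈⟨ *-assoc x⁻¹ x z ⟨
    x⁻¹ * x * z       ≈⟨ *-congʳ x⁻¹x≈1 ⟩
    1# * z            ≈⟨ *-identityˡ z ⟩
    z                 ∎
    where
    x⁻¹ : Carrier
    x⁻¹ = (x ⁻¹) x≉0
    x⁻¹x≈1 : x⁻¹ * x ≈ 1#
    x⁻¹x≈1 = trans (*-comm x⁻¹ x) (*-inverseʳ x x≉0)

  *-nonzero : ∀ {x y} → Nonzero x → Nonzero y → Nonzero (x * y)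
  *-nonzero {x} x≉0 y≉0 xy≈0 = y≉0 (*-cancelˡ x≉0 (trans xy≈0 (sym (zeroʳ x))))

  ^-nonzero : ∀ {x} n → Nonzero x → Nonzero (x ^ n)
  ^-nonzero zero    _   = 1≉0
  ^-nonzero (suc n) x≉0 = *-nonzero x≉0 (^-nonzero n x≉0)

  1^n≈1 : ∀ n → 1# ^ n ≈ 1#
  1^n≈1 zero    = refl
  1^n≈1 (suc n) = trans (*-identityˡ _) (1^n≈1 n)

  -- a monic polynomial of degree d, given by its d lower coefficients c₀, …, c_{d-1}
  evalMonic : ∀ {d} → Vec Carrier d → Carrier → Carrier
  evalMonic []      x = 1#
  evalMonic (c ∷ v) x = c + x * evalMonic v x

  x≈x-r+r : ∀ x r → x ≈ x - r + r
  x≈x-r+r x r = sym (+-Group.//-rightDividesˡ r x)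

  -- once x is written as (x - r) + r, both cases are semiring identities
  factor-theorem : ∀ {d} (v : Vec Carrier (suc d)) r → Σ (Vec Carrier d) λ w →
                   ∀ x → evalMonic v x ≈ (x - r) * evalMonic w x + evalMonic v r
  factor-theorem (c ∷ []) r = [] , λ x → begin
    c + x * 1#                  ≈⟨ +-congˡ (*-congʳ (x≈x-r+r x r)) ⟩
    c + (x - r + r) * 1#        ≈⟨ solve 3 (λ c a r → c :+ (a :+ r) :* con 1 := a :* con 1 :+ (c :+ r :* con 1))
                                     refl c (x - r) r ⟩
    (x - r) * 1# + (c + r * 1#) ∎
  factor-theorem (c ∷ v@(_ ∷ _)) r with factor-theorem v r
  ... | w , v≈ = (evalMonic v r ∷ w) , λ x → let W = evalMonic w x ; V = evalMonic v r in begin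
    c + x * evalMonic v x                         ≈⟨ +-congˡ (*-congˡ (v≈ x)) ⟩
    c + x * ((x - r) * W + V)                     ≈⟨ +-congˡ (*-congʳ (x≈x-r+r x r)) ⟩
    c + (x - r + r) * ((x - r) * W + V)           ≈⟨ solve 5 (λ c a r W V → c :+ (a :+ r) :* (a :* W :+ V)
                                                       := a :* (V :+ (a :+ r) :* W) :+ (c :+ r :* V)) refl c (x - r) r W V ⟩
    (x - r) * (V + (x - r + r) * W) + (c + r * V) ≈⟨ +-congʳ (*-congˡ (+-congˡ (*-congʳ (x≈x-r+r x r)))) ⟨
    (x - r) * (V + x * W) + (c + r * V)           ∎

  roots≤degree : ∀ {d n} (v : Vec Carrier d) (f : Fin n → Carrier) → Injective _≡_ _≈_ f →
                 (∀ i → evalMonic v (f i) ≈ 0#) → n ≤ d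
  roots≤degree {n = zero}  _  _ _ _ = z≤n
  roots≤degree {n = suc n} [] f _ root = ⊥-elim (1≉0 (root zero))
  roots≤degree {n = suc n} v@(_ ∷ _) f f-injective root with factor-theorem v (f zero)
  ... | w , v≈ = s≤s (roots≤degree w (f ∘ suc) (suc-injective ∘ f-injective) root-of-w)
    where
    root-of-w : ∀ i → evalMonic w (f (suc i)) ≈ 0#
    root-of-w i = *-cancelˡ x-r≉0 (begin
      (x - r) * evalMonic w x                  ≈⟨ +-identityʳ _ ⟨
      (x - r) * evalMonic w x + 0#             ≈⟨ +-congˡ (root zero) ⟨
      (x - r) * evalMonic w x + evalMonic v r  ≈⟨ v≈ x ⟨
      evalMonic v x                            ≈⟨ root (suc i) ⟩
      0#                                       ≈⟨ zeroʳ (x - r) ⟨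
      (x - r) * 0#                             ∎)
      where
      x r : Carrier
      x = f (suc i)
      r = f zero
      x-r≉0 : Nonzero (x - r)
      x-r≉0 x-r≈0 with f-injective (+-Group.x∙y⁻¹≈ε⇒x≈y x r x-r≈0)
      ... | ()

  unityPolynomial : ∀ k → Vec Carrier (suc k)
  unityPolynomial k = - 1# ∷ replicate k 0#

  unityPolynomial-root : ∀ k {x} → x ^ suc k ≈ 1# → evalMonic (unityPolynomial k) x ≈ 0#
  unityPolynomial-root k {x} xᵏ⁺¹≈1 = begin
    - 1# + x * evalMonic (replicate k 0#) x ≈⟨ +-congˡ (*-congˡ (evalMonic-replicate-0 k)) ⟩
    - 1# + x ^ suc k                       ≈⟨ +-congˡ xᵏ⁺¹≈1 ⟩
    - 1# + 1#                              ≈⟨ -‿inverseˡ 1# ⟩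
    0#                                     ∎
    where
    evalMonic-replicate-0 : ∀ k → evalMonic (replicate k 0#) x ≈ x ^ k
    evalMonic-replicate-0 zero    = refl
    evalMonic-replicate-0 (suc k) = trans (+-identityˡ _) (*-congˡ (evalMonic-replicate-0 k))

  roots-of-unity≤ : ∀ {n m} → 0 < m → (f : Fin n → Carrier) → Injective _≡_ _≈_ f →
                    (∀ i → f i ^ m ≈ 1#) → n ≤ m
  roots-of-unity≤ {m = suc k} _ f f-injective root =
    roots≤degree (unityPolynomial k) f f-injective (unityPolynomial-root k ∘ root)

module FiniteField (K : CommutativeRing 0ℓ 0ℓ) (isField : IsField K) (N : ℕ)
                   (card : HasCardinality (CommutativeRing.setoid K) (suc N)) where

  open import Data.Empty using (⊥-elim)
  open import Data.Fin.Base using (Fin; toℕ; punchIn; punchOut)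
  import Data.Fin.Properties as Fin
  open import Data.Nat.Base as ℕ using (ℕ; zero; suc; _≤_; _<_; z≤n; s≤s; z<s; _∸_; _%_; _/_)
  open import Data.Nat.Coprimality using (Coprime)
  import Data.Nat.Coprimality as Coprime
  open import Data.Nat.DivMod using (m≡m%n+[m/n]*n; m%n<n)
  open import Data.Nat.Divisibility
    using (_∣_; _∣?_; divides; m%n≡0⇒n∣m; *-cancelˡ-∣; ∣-antisym; ∣-trans; m∣m*n; n∣m*n; 1∣_)
  open import Data.Nat.GCD using (module Bézout)
  open import Data.Nat.Induction using (<-rec)
  open import Data.Nat.Primality using (Prime; prime⇒nonZero; prime⇒nonTrivial)
  import Data.Nat.Properties as ℕ
  open import Data.Product.Base using (Σ; _×_; _,_; proj₁; proj₂)
  open import Data.Sum.Base using (inj₁; inj₂)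
  open import Function.Base using (_∘_)
  open import Function.Bundles using (Bijection)
  open import Function.Definitions using (Injective)
  open import Relation.Binary.Definitions using (Decidable)
  open import Relation.Binary.PropositionalEquality as ≡ using (_≡_; _≢_)
  open import Relation.Nullary using (yes; no)
  import Relation.Nullary.Decidable as Dec

  open CommutativeRing K hiding (zero)
  open FieldRoots K isField public
  open import Relation.Binary.Reasoning.Setoid setoid
  open Arithmetic
  open Counting using (argmax; injective⇒surjective)

  -- the nonzero elements are enumerated by Fin N, skipping the position of 0#
  private
    module E = Bijection card

    enumerate : Fin (suc N) → Carrier
    enumerate = E.to

    position : Carrier → Fin (suc N)
    position = E.to⁻

    enumerate-position : ∀ x → enumerate (position x) ≈ x
    enumerate-position = proj₂ ∘ E.strictlySurjective

    position-enumerate : ∀ k → position (enumerate k) ≡ k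
    position-enumerate k = E.injective (enumerate-position (enumerate k))

    position-injective : ∀ {x y} → position x ≡ position y → x ≈ y
    position-injective {x} {y} eq = trans (sym (enumerate-position x)) (trans (E.cong eq) (enumerate-position y))

    position-cong : ∀ {x y} → x ≈ y → position x ≡ position y
    position-cong {x} {y} x≈y = E.injective (trans (enumerate-position x) (trans x≈y (sym (enumerate-position y))))

    position-nonzero : ∀ {x} → Nonzero x → position 0# ≢ position x
    position-nonzero x≉0 eq = x≉0 (position-injective (≡.sym eq))

  infix 4 _≟_
  _≟_ : Decidable _≈_
  x ≟ y = Dec.map′ position-injective position-cong (position x Fin.≟ position y)

  nonzeroAt : Fin N → Carrier
  nonzeroAt j = enumerate (punchIn (position 0#) j)

  nonzeroIndex : ∀ x → Nonzero x → Fin N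
  nonzeroIndex x x≉0 = punchOut (position-nonzero x≉0)

  nonzeroAt-nonzero : ∀ j → Nonzero (nonzeroAt j)
  nonzeroAt-nonzero j jth≈0 =
    Fin.punchInᵢ≢i _ j (≡.trans (≡.sym (position-enumerate _)) (position-cong jth≈0))

  nonzeroAt-injective : Injective _≡_ _≈_ nonzeroAt
  nonzeroAt-injective = Fin.punchIn-injective _ _ _ ∘ E.injective

  nonzeroAt-nonzeroIndex : ∀ x (x≉0 : Nonzero x) → nonzeroAt (nonzeroIndex x x≉0) ≈ x
  nonzeroAt-nonzeroIndex x x≉0 = trans (E.cong (Fin.punchIn-punchOut (position-nonzero x≉0))) (enumerate-position x)

  nonzeroIndex-injective : ∀ {x y} (x≉0 : Nonzero x) (y≉0 : Nonzero y) →
                           nonzeroIndex x x≉0 ≡ nonzeroIndex y y≉0 → x ≈ y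
  nonzeroIndex-injective {x} {y} x≉0 y≉0 eq =
    trans (sym (nonzeroAt-nonzeroIndex x x≉0)) (trans (reflexive (≡.cong nonzeroAt eq)) (nonzeroAt-nonzeroIndex y y≉0))

  record HasOrder (x : Carrier) (m : ℕ) : Set where
    field
      order>0 : 0 < m
      ^order  : x ^ m ≈ 1#
      order∣  : ∀ {t} → x ^ t ≈ 1# → m ∣ t

  open HasOrder

  ^-∸≈1 : ∀ {x} → Nonzero x → ∀ {a b} → a ≤ b → x ^ a ≈ x ^ b → x ^ (b ∸ a) ≈ 1#
  ^-∸≈1 {x} x≉0 {a} {b} a≤b xᵃ≈xᵇ = *-cancelˡ (^-nonzero a x≉0) (begin
    x ^ a * x ^ (b ∸ a) ≈⟨ ^-homo-* x a (b ∸ a) ⟨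
    x ^ (a ℕ.+ (b ∸ a)) ≡⟨ ≡.cong (x ^_) (ℕ.m+[n∸m]≡n a≤b) ⟩
    x ^ b               ≈⟨ xᵃ≈xᵇ ⟨
    x ^ a               ≈⟨ *-identityʳ _ ⟨
    x ^ a * 1#          ∎)

  ^-multiple≈1 : ∀ {x m} → x ^ m ≈ 1# → ∀ {t} → m ∣ t → x ^ t ≈ 1#
  ^-multiple≈1 {x} {m} xᵐ≈1 (divides q ≡.refl) = begin
    x ^ (q ℕ.* m) ≡⟨ ≡.cong (x ^_) (ℕ.*-comm q m) ⟩
    x ^ (m ℕ.* q) ≈⟨ ^-assocʳ x m q ⟨
    (x ^ m) ^ q   ≈⟨ ^-congˡ q xᵐ≈1 ⟩
    1# ^ q        ≈⟨ 1^n≈1 q ⟩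
    1#            ∎

  ^-% : ∀ {x m} .{{_ : ℕ.NonZero m}} → x ^ m ≈ 1# → ∀ t → x ^ t ≈ x ^ (t % m)
  ^-% {x} {m} xᵐ≈1 t = begin
    x ^ t                                ≡⟨ ≡.cong (x ^_) (m≡m%n+[m/n]*n t m) ⟩
    x ^ (t % m ℕ.+ t / m ℕ.* m)          ≈⟨ ^-homo-* x (t % m) (t / m ℕ.* m) ⟩
    x ^ (t % m) * x ^ (t / m ℕ.* m)      ≈⟨ *-congˡ (^-multiple≈1 {x} {m} xᵐ≈1 (divides (t / m) ≡.refl)) ⟩
    x ^ (t % m) * 1#                     ≈⟨ *-identityʳ _ ⟩
    x ^ (t % m)                          ∎

  periodic : ∀ {x} → Nonzero x → Σ ℕ λ d → 0 < d × x ^ d ≈ 1#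
  periodic {x} x≉0 with Fin.pigeonhole (ℕ.n<1+n N) (λ i → nonzeroIndex (x ^ toℕ i) (^-nonzero (toℕ i) x≉0))
  ... | i , j , i<j , same = toℕ j ∸ toℕ i , ℕ.m<n⇒0<n∸m i<j ,
    ^-∸≈1 x≉0 (ℕ.<⇒≤ i<j) (nonzeroIndex-injective (^-nonzero (toℕ i) x≉0) (^-nonzero (toℕ j) x≉0) same)

  -- the order is the least positive period; abstract, since unfolding the search makes type checking crawl
  abstract
    order : ∀ {x} → Nonzero x → Σ ℕ (HasOrder x)
    order {x} x≉0 with periodic x≉0
    ... | d , d>0 , xᵈ≈1 with least (λ k → (0 ℕ.<? k) Dec.×-dec (x ^ k ≟ 1#)) (d>0 , xᵈ≈1)
    ...   | m@(suc _) , (m>0 , xᵐ≈1) , below = m , record { order>0 = m>0 ; ^order = xᵐ≈1 ; order∣ = order∣′ }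
      where
      order∣′ : ∀ {t} → x ^ t ≈ 1# → m ∣ t
      order∣′ {t} xᵗ≈1 with t % m in eq | m%n<n t m
      ... | zero  | _   = m%n≡0⇒n∣m t m eq
      ... | suc k | k<m = ⊥-elim (below k<m (z<s , trans (sym (trans (^-% xᵐ≈1 t) (reflexive (≡.cong (x ^_) eq)))) xᵗ≈1))

  HasOrder-unique : ∀ {x m m′} → HasOrder x m → HasOrder x m′ → m ≡ m′
  HasOrder-unique o o′ = ∣-antisym (order∣ o (^order o′)) (order∣ o′ (^order o))

  HasOrder-resp-≈ : ∀ {x y m} → x ≈ y → HasOrder x m → HasOrder y m
  HasOrder-resp-≈ {m = m} x≈y o = record
    { order>0 = order>0 o
    ; ^order  = trans (^-congˡ m (sym x≈y)) (^order o)
    ; order∣  = λ {t} yᵗ≈1 → order∣ o (trans (^-congˡ t x≈y) yᵗ≈1)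
    }

  HasOrder-^ : ∀ {x} e {f} .{{_ : ℕ.NonZero e}} → HasOrder x (e ℕ.* f) → HasOrder (x ^ e) f
  HasOrder-^ {x} e {f} o = record
    { order>0 = ℕ.>-nonZero⁻¹ f {{ℕ.m*n≢0⇒n≢0 e {{ℕ.>-nonZero (order>0 o)}}}}
    ; ^order  = trans (^-assocʳ x e f) (^order o)
    ; order∣  = λ {t} xᵉᵗ≈1 → *-cancelˡ-∣ e (order∣ o (trans (sym (^-assocʳ x e t)) xᵉᵗ≈1))
    }

  HasOrder-* : ∀ {x y r s} → HasOrder x r → HasOrder y s → Coprime r s → HasOrder (x * y) (r ℕ.* s)
  HasOrder-* {x} {y} {r} {s} oˣ oʸ r⊥s = record
    { order>0 = ℕ.>-nonZero⁻¹ (r ℕ.* s) {{ℕ.m*n≢0 r s {{ℕ.>-nonZero (order>0 oˣ)}} {{ℕ.>-nonZero (order>0 oʸ)}}}}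
    ; ^order  = begin
        (x * y) ^ (r ℕ.* s)           ≈⟨ ^-distrib-* x y (r ℕ.* s) ⟩
        x ^ (r ℕ.* s) * y ^ (r ℕ.* s) ≈⟨ *-cong (^-multiple≈1 {x} {r} (^order oˣ) (m∣m*n s))
                                                (^-multiple≈1 {y} {s} (^order oʸ) (n∣m*n r)) ⟩
        1# * 1#                       ≈⟨ *-identityˡ 1# ⟩
        1#                            ∎
    ; order∣  = λ {t} xyᵗ≈1 → coprime-∣⇒*∣ r⊥s (factor∣ oˣ oʸ r⊥s xyᵗ≈1)
                  (factor∣ oʸ oˣ (Coprime.sym r⊥s) (trans (^-congˡ t (*-comm y x)) xyᵗ≈1))
    }
    where
    -- raising to the power s kills y, so x^(s t) = 1 and r ∣ s t
    factor∣ : ∀ {x y r s t} → HasOrder x r → HasOrder y s → Coprime r s → (x * y) ^ t ≈ 1# → r ∣ t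
    factor∣ {x} {y} {r} {s} {t} oˣ oʸ r⊥s xyᵗ≈1 = Coprime.coprime-divisor r⊥s (order∣ oˣ (begin
      x ^ (s ℕ.* t)                 ≈⟨ *-identityʳ _ ⟨
      x ^ (s ℕ.* t) * 1#            ≈⟨ *-congˡ (^-multiple≈1 {y} {s} (^order oʸ) (m∣m*n t)) ⟨
      x ^ (s ℕ.* t) * y ^ (s ℕ.* t) ≈⟨ ^-distrib-* x y (s ℕ.* t) ⟨
      (x * y) ^ (s ℕ.* t)           ≡⟨ ≡.cong ((x * y) ^_) (ℕ.*-comm s t) ⟩
      (x * y) ^ (t ℕ.* s)           ≈⟨ ^-assocʳ (x * y) t s ⟨
      ((x * y) ^ t) ^ s             ≈⟨ ^-congˡ s xyᵗ≈1 ⟩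
      1# ^ s                        ≈⟨ 1^n≈1 s ⟩
      1#                            ∎))

  ^-injective : ∀ {x m} → Nonzero x → HasOrder x m → ∀ {i j} → i < m → j < m → x ^ i ≈ x ^ j → i ≡ j
  ^-injective x≉0 o {i} {j} i<m j<m xⁱ≈xʲ with ℕ.≤-total i j
  ... | inj₁ i≤j = ∣∸∧<⇒≡ i≤j j<m (order∣ o (^-∸≈1 x≉0 i≤j xⁱ≈xʲ))
  ... | inj₂ j≤i = ≡.sym (∣∸∧<⇒≡ j≤i i<m (order∣ o (^-∸≈1 x≉0 j≤i (sym xⁱ≈xʲ))))

  HasOrder-≤ : ∀ {x m} → Nonzero x → HasOrder x m → m ≤ N
  HasOrder-≤ {x} x≉0 o = Fin.injective⇒≤ λ {i} {j} same →
    Fin.toℕ-injective (^-injective x≉0 o (Fin.toℕ<n i) (Fin.toℕ<n j)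
      (nonzeroIndex-injective (^-nonzero (toℕ i) x≉0) (^-nonzero (toℕ j) x≉0) same))

  module MaximalOrder {a m} (a≉0 : Nonzero a) (oᵃ : HasOrder a m)
                      (maximal : ∀ {y n} → Nonzero y → HasOrder y n → n ≤ m) where

    -- otherwise m = pʲ m₀ with j < k, and c · a^(pʲ) would have order pᵏ m₀ > m
    prime-power-order∣ : ∀ {p c} k → Prime p → Nonzero c → HasOrder c (p ℕ.^ k) → p ℕ.^ k ∣ m
    prime-power-order∣ {p} {c} k pp c≉0 oᶜ with p ℕ.^ k ∣? m
    ... | yes pᵏ∣m = pᵏ∣m
    ... | no pᵏ∤m with prime-power-split pp m (order>0 oᵃ)
    ...   | j , m₀ , m≡pʲm₀ , p∤m₀ =
      ⊥-elim (ℕ.<-irrefl ≡.refl (ℕ.<-≤-trans m<pᵏm₀ (maximal product≉0 o-product)))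
      where
      instance
        p≢0 : ℕ.NonZero p
        p≢0 = prime⇒nonZero pp
      j<k : j < k
      j<k = ℕ.≰⇒> λ k≤j →
        pᵏ∤m (∣-trans (m^n∣m^o p k≤j) (divides m₀ (≡.trans m≡pʲm₀ (ℕ.*-comm _ m₀))))
      m₀≢0 : ℕ.NonZero m₀
      m₀≢0 = ℕ.m*n≢0⇒n≢0 (p ℕ.^ j) {{≡.subst ℕ.NonZero m≡pʲm₀ (ℕ.>-nonZero (order>0 oᵃ))}}
      m<pᵏm₀ : m < p ℕ.^ k ℕ.* m₀
      m<pᵏm₀ = ≡.subst (_< p ℕ.^ k ℕ.* m₀) (≡.sym m≡pʲm₀)
                 (ℕ.*-monoˡ-< m₀ {{m₀≢0}} (ℕ.^-monoʳ-< p (ℕ.nonTrivial⇒n>1 p {{prime⇒nonTrivial pp}}) j<k))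
      product≉0 : Nonzero (c * a ^ (p ℕ.^ j))
      product≉0 = *-nonzero c≉0 (^-nonzero (p ℕ.^ j) a≉0)
      o-product : HasOrder (c * a ^ (p ℕ.^ j)) (p ℕ.^ k ℕ.* m₀)
      o-product = HasOrder-* oᶜ (HasOrder-^ (p ℕ.^ j) {{ℕ.m^n≢0 p j}} (≡.subst (HasOrder a) m≡pʲm₀ oᵃ))
                   (coprime-^ˡ (prime∤⇒coprime pp p∤m₀) k)

    order∣maximal : ∀ {y n} → Nonzero y → HasOrder y n → n ∣ m
    order∣maximal {n = n} = <-rec (λ n → ∀ {y} → Nonzero y → HasOrder y n → n ∣ m) step n
      where
      step : ∀ n → (∀ {n′} → n′ < n → ∀ {y} → Nonzero y → HasOrder y n′ → n′ ∣ m) →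
             ∀ {y} → Nonzero y → HasOrder y n → n ∣ m
      step (suc zero)      _   _   _  = 1∣ m
      step n@(suc (suc _)) rec {y} y≉0 oʸ
        with p , pp , p∣n ← prime-factor n (s≤s (s≤s z≤n))
        with k , n₀ , n≡pᵏn₀ , p∤n₀ ← prime-power-split pp n z<s =
        ≡.subst (_∣ m) (≡.sym n≡pᵏn₀) (coprime-∣⇒*∣ (coprime-^ˡ (prime∤⇒coprime pp p∤n₀) k) pᵏ∣m n₀∣m)
        where
        instance
          n₀≢0 : ℕ.NonZero n₀
          n₀≢0 = ℕ.m*n≢0⇒n≢0 (p ℕ.^ k) {{≡.subst ℕ.NonZero n≡pᵏn₀ _}}
          pᵏ≢0 : ℕ.NonZero (p ℕ.^ k)
          pᵏ≢0 = ℕ.m^n≢0 p k {{prime⇒nonZero pp}}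
        0<k : 0 < k
        0<k = ℕ.n≢0⇒n>0 λ k≡0 → p∤n₀ (≡.subst (p ∣_)
          (≡.trans n≡pᵏn₀ (≡.trans (≡.cong (λ k → p ℕ.^ k ℕ.* n₀) k≡0) (ℕ.*-identityˡ n₀))) p∣n)
        1<pᵏ : 1 < p ℕ.^ k
        1<pᵏ = ℕ.^-monoʳ-< p (ℕ.nonTrivial⇒n>1 p {{prime⇒nonTrivial pp}}) 0<k
        oʸ′ : HasOrder y (p ℕ.^ k ℕ.* n₀)
        oʸ′ = ≡.subst (HasOrder y) n≡pᵏn₀ oʸ
        pᵏ∣m : p ℕ.^ k ∣ m
        pᵏ∣m = prime-power-order∣ k pp (^-nonzero n₀ y≉0)
                 (HasOrder-^ n₀ (≡.subst (HasOrder y) (ℕ.*-comm (p ℕ.^ k) n₀) oʸ′))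
        n₀∣m : n₀ ∣ m
        n₀∣m = rec (≡.subst (n₀ <_) (≡.trans (ℕ.*-comm n₀ _) (≡.sym n≡pᵏn₀)) (ℕ.m<m*n n₀ _ 1<pᵏ))
                   (^-nonzero (p ℕ.^ k) y≉0) (HasOrder-^ (p ℕ.^ k) oʸ′)

  -- take g of maximal order m; as every order divides m, all N nonzero elements are roots of Xᵐ - 1
  generator : 0 < N → Σ Carrier λ g → Nonzero g × HasOrder g N
  generator (s≤s _) = g , g≉0 , ≡.subst (HasOrder g) m≡N oᵍ
    where
    ord : Fin N → ℕ
    ord j = proj₁ (order (nonzeroAt-nonzero j))
    o : ∀ j → HasOrder (nonzeroAt j) (ord j)
    o j = proj₂ (order (nonzeroAt-nonzero j))
    j* : Fin N
    j* = proj₁ (argmax ord)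
    g : Carrier
    g = nonzeroAt j*
    g≉0 : Nonzero g
    g≉0 = nonzeroAt-nonzero j*
    m : ℕ
    m = ord j*
    oᵍ : HasOrder g m
    oᵍ = o j*
    maximal : ∀ {y n} → Nonzero y → HasOrder y n → n ≤ m
    maximal {y} y≉0 oʸ = ≡.subst (_≤ m) (HasOrder-unique (o i) (HasOrder-resp-≈ (sym (nonzeroAt-nonzeroIndex y y≉0)) oʸ))
                           (proj₂ (argmax ord) i)
      where i = nonzeroIndex y y≉0
    open MaximalOrder g≉0 oᵍ maximal
    all-roots : ∀ j → nonzeroAt j ^ m ≈ 1#
    all-roots j = ^-multiple≈1 {m = ord j} (^order (o j)) (order∣maximal (nonzeroAt-nonzero j) (o j))
    m≡N : m ≡ N
    m≡N = ℕ.≤-antisym (HasOrder-≤ g≉0 oᵍ) (roots-of-unity≤ (order>0 oᵍ) nonzeroAt nonzeroAt-injective all-roots)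

  module Generator {g} (g≉0 : Nonzero g) (oᵍ : HasOrder g N) where

    abstract
      discreteLog : ∀ {x} → Nonzero x → Σ ℕ λ i → i < N × g ^ i ≈ x
      discreteLog {x} x≉0 with injective⇒surjective gⁱ-injective (nonzeroIndex x x≉0)
        where
        gⁱ-injective : Injective _≡_ _≡_ (λ (i : Fin N) → nonzeroIndex (g ^ toℕ i) (^-nonzero (toℕ i) g≉0))
        gⁱ-injective {i} {j} same = Fin.toℕ-injective (^-injective g≉0 oᵍ (Fin.toℕ<n i) (Fin.toℕ<n j)
          (nonzeroIndex-injective (^-nonzero (toℕ i) g≉0) (^-nonzero (toℕ j) g≉0) same))
      ... | i , same = toℕ i , Fin.toℕ<n i , nonzeroIndex-injective (^-nonzero (toℕ i) g≉0) x≉0 same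

    ^N≈1 : ∀ {x} → Nonzero x → x ^ N ≈ 1#
    ^N≈1 {x} x≉0 with i , _ , gⁱ≈x ← discreteLog x≉0 = begin
      x ^ N           ≈⟨ ^-congˡ N gⁱ≈x ⟨
      (g ^ i) ^ N     ≈⟨ ^-assocʳ g i N ⟩
      g ^ (i ℕ.* N)   ≈⟨ ^-multiple≈1 {g} {N} (^order oᵍ) (n∣m*n i) ⟩
      1#              ∎

    inverse^[N∸1] : ∀ {w z} → Nonzero z → w * z ≈ 1# → w ^ (N ∸ 1) ≈ z
    inverse^[N∸1] {w} {z} z≉0 wz≈1 = *-cancelˡ (^-nonzero (N ∸ 1) z≉0) (begin
      z ^ (N ∸ 1) * w ^ (N ∸ 1) ≈⟨ *-comm _ _ ⟩
      w ^ (N ∸ 1) * z ^ (N ∸ 1) ≈⟨ ^-distrib-* w z (N ∸ 1) ⟨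
      (w * z) ^ (N ∸ 1)         ≈⟨ ^-congˡ (N ∸ 1) wz≈1 ⟩
      1# ^ (N ∸ 1)              ≈⟨ 1^n≈1 (N ∸ 1) ⟩
      1#                        ≈⟨ ^N≈1 z≉0 ⟨
      z ^ N                     ≡⟨ ≡.cong (z ^_) (ℕ.m+[n∸m]≡n (order>0 oᵍ)) ⟨
      z * z ^ (N ∸ 1)           ≈⟨ *-comm _ _ ⟩
      z ^ (N ∸ 1) * z           ∎)

    ^-inverse : ∀ {a} → Coprime a N → Σ ℕ λ b → ∀ {z} → Nonzero z → (z ^ a) ^ b ≈ z
    ^-inverse {a} a⊥N with Coprime.coprime-Bézout a⊥N
    ... | Bézout.+- x y 1+yN≡xa = x , λ {z} z≉0 → begin
      (z ^ a) ^ x         ≈⟨ ^-assocʳ z a x ⟩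
      z ^ (a ℕ.* x)       ≡⟨ ≡.cong (z ^_) (≡.trans (ℕ.*-comm a x) (≡.sym 1+yN≡xa)) ⟩
      z * z ^ (y ℕ.* N)   ≈⟨ *-congˡ (^-multiple≈1 {z} {N} (^N≈1 z≉0) (n∣m*n y)) ⟩
      z * 1#              ≈⟨ *-identityʳ z ⟩
      z                   ∎
    ... | Bézout.-+ x y 1+xa≡yN = x ℕ.* (N ∸ 1) , λ {z} z≉0 → begin
      (z ^ a) ^ (x ℕ.* (N ∸ 1)) ≈⟨ ^-assocʳ (z ^ a) x (N ∸ 1) ⟨
      ((z ^ a) ^ x) ^ (N ∸ 1)   ≈⟨ inverse^[N∸1] z≉0 (inverse z≉0) ⟩
      z                         ∎
      where
      inverse : ∀ {z} → Nonzero z → (z ^ a) ^ x * z ≈ 1#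
      inverse {z} z≉0 = begin
        (z ^ a) ^ x * z   ≈⟨ *-comm _ z ⟩
        z * (z ^ a) ^ x   ≈⟨ *-congˡ (^-assocʳ z a x) ⟩
        z * z ^ (a ℕ.* x) ≡⟨ ≡.cong (λ e → z * z ^ e) (ℕ.*-comm a x) ⟩
        z ^ (1 ℕ.+ x ℕ.* a) ≡⟨ ≡.cong (z ^_) 1+xa≡yN ⟩
        z ^ (y ℕ.* N)     ≈⟨ ^-multiple≈1 {z} {N} (^N≈1 z≉0) (n∣m*n y) ⟩
        1#                ∎

module SubfieldRing (K : CommutativeRing 0ℓ 0ℓ) (F : Subfield K) where

  open import Algebra.Bundles using (RawRing)
  import Algebra.Morphism.RingMonomorphism as RingMonomorphism
  open import Algebra.Morphism.Structures using (IsRingMonomorphism)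
  open import Data.Product.Base using (Σ; _,_; proj₁; proj₂)
  open import Function.Base using (id)
  open import Function.Bundles using (Bijection)

  open CommutativeRing K
  open Subfield F

  subRawRing : RawRing 0ℓ 0ℓ
  subRawRing = record
    { Carrier = Σ Carrier P
    ; _≈_     = λ a b → proj₁ a ≈ proj₁ b
    ; _+_     = λ (a , pa) (b , pb) → a + b , P-+ pa pb
    ; _*_     = λ (a , pa) (b , pb) → a * b , P-* pa pb
    ; -_      = λ (a , pa) → - a , P-- pa
    ; 0#      = 0# , P-0
    ; 1#      = 1# , P-1
    }

  inclusion-isRingMonomorphism : IsRingMonomorphism subRawRing rawRing proj₁
  inclusion-isRingMonomorphism = record
    { isRingHomomorphism = record
      { isSemiringHomomorphism = record
        { isNearSemiringHomomorphism = record
          { +-isMonoidHomomorphism = record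
            { isMagmaHomomorphism = record
              { isRelHomomorphism = record { cong = id }
              ; homo = λ _ _ → refl
              }
            ; ε-homo = refl
            }
          ; *-homo = λ _ _ → refl
          }
        ; 1#-homo = refl
        }
      ; -‿homo = λ _ → refl
      }
    ; injective = id
    }

  subCommutativeRing : CommutativeRing 0ℓ 0ℓ
  subCommutativeRing = record
    { RawRing subRawRing
    ; isCommutativeRing = RingMonomorphism.isCommutativeRing inclusion-isRingMonomorphism isCommutativeRing
    }

  sub-isField : IsField K → IsField subCommutativeRing
  sub-isField (1≉0 , inverse) = 1≉0 , λ (x , px) x≉0 →
    let y , xy≈1 = inverse x x≉0 in (y , P-inv px xy≈1) , xy≈1

  sub-cardinality : ∀ {n} → HasCardinality (SubfieldSetoid K F) n → HasCardinality (CommutativeRing.setoid subCommutativeRing) n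
  sub-cardinality card = record { Bijection card }

module Automorphisms (K : CommutativeRing 0ℓ 0ℓ) (isField : IsField K) (F : Subfield K)
  (r : ℕ) (r>0 : 0 < r)
  (cardK : HasCardinality (CommutativeRing.setoid K) (suc (Totient.UnitExponents.N r)))
  (cardF : HasCardinality (SubfieldSetoid K F) (suc r)) where

  open import Data.Empty using (⊥-elim)
  open import Data.Fin.Base using (Fin; zero; suc)
  import Data.Fin.Properties as Fin
  open import Data.Nat.Base as ℕ using (ℕ; zero; suc; _<_; _≤_; z<s; _∸_)
  open import Data.Nat.Coprimality using (Coprime)
  open import Data.Nat.Divisibility using (_∣_; ∣1⇒≡1; ∣m+n∣m⇒∣n; ∣n⇒∣m*n; ∣-trans; *-cancelʳ-∣)
  import Data.Nat.Properties as ℕ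
  open import Data.Product.Base using (Σ; _,_; proj₁; proj₂)
  open import Function.Definitions using (Injective)
  open import Relation.Binary.Bundles using (Setoid)
  open import Relation.Binary.PropositionalEquality as ≡ using (_≡_)
  open import Relation.Nullary using (Dec; yes; no)

  open Arithmetic using (¬coprime-0; ¬coprime-self)
  open Counting using (count; nth; nth-<; nth-satisfies; nth-injective; nth-surjective)
  open Totient.UnitExponents r using (L; N; 1<L; IsUnitExponent; unitExponent?)
  open SubfieldRing K F

  open CommutativeRing K hiding (zero)
  open Subfield F
  open FiniteField K isField N cardK
  open import Relation.Binary.Reasoning.Setoid setoid

  module 𝔽 = FiniteField subCommutativeRing (sub-isField isField) r (sub-cardinality cardF)

  N>0 : 0 < N
  N>0 = ℕ.*-mono-< r>0 z<s

  1<N : 1 < N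
  1<N = ℕ.<-≤-trans 1<L (ℕ.m≤n*m L r {{ℕ.>-nonZero r>0}})

  g : Carrier
  g = proj₁ (generator N>0)

  g≉0 : Nonzero g
  g≉0 = proj₁ (proj₂ (generator N>0))

  oᵍ : HasOrder g N
  oᵍ = proj₂ (proj₂ (generator N>0))

  open Generator g≉0 oᵍ
  open HasOrder

  subfield-^ : ∀ x n → proj₁ (x 𝔽.^ n) ≈ proj₁ x ^ n
  subfield-^ x zero    = refl
  subfield-^ x (suc n) = *-congˡ (subfield-^ x n)

  F*-^r≈1 : ∀ {x} → Nonzero x → P x → x ^ r ≈ 1#
  F*-^r≈1 {x} x≉0 px with _ , h≉0 , oʰ ← 𝔽.generator r>0 =
    trans (sym (subfield-^ (x , px) r)) (𝔽.Generator.^N≈1 h≉0 oʰ x≉0)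

  F*-member? : ∀ {x} → Nonzero x → Dec (P x)
  F*-member? {x} x≉0 with Fin.any? (λ i → proj₁ (𝔽.nonzeroAt i) ≟ x)
  ... | yes (i , xᵢ≈x) = yes (P-resp xᵢ≈x (proj₂ (𝔽.nonzeroAt i)))
  ... | no ∉ = no λ px → ∉ (𝔽.nonzeroIndex (x , px) x≉0 , 𝔽.nonzeroAt-nonzeroIndex (x , px) x≉0)

  -- otherwise g^L and the r elements of F* would be r + 1 roots of Xʳ - 1
  g^L∈F : P (g ^ L)
  g^L∈F with F*-member? (^-nonzero L g≉0)
  ... | yes g^L∈F = g^L∈F
  ... | no  g^L∉F = ⊥-elim (ℕ.<-irrefl ≡.refl (roots-of-unity≤ r>0 root root-injective root-^r≈1))
    where
    root : Fin (suc r) → Carrier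
    root zero    = g ^ L
    root (suc i) = proj₁ (𝔽.nonzeroAt i)
    root-injective : Injective _≡_ _≈_ root
    root-injective {zero}  {zero}  _ = ≡.refl
    root-injective {zero}  {suc j} e = ⊥-elim (g^L∉F (P-resp (sym e) (proj₂ (𝔽.nonzeroAt j))))
    root-injective {suc i} {zero}  e = ⊥-elim (g^L∉F (P-resp e (proj₂ (𝔽.nonzeroAt i))))
    root-injective {suc i} {suc j} e = ≡.cong suc (𝔽.nonzeroAt-injective e)
    root-^r≈1 : ∀ i → root i ^ r ≈ 1#
    root-^r≈1 zero    = begin
      (g ^ L) ^ r   ≈⟨ ^-assocʳ g L r ⟩
      g ^ (L ℕ.* r) ≡⟨ ≡.cong (g ^_) (ℕ.*-comm L r) ⟩
      g ^ N         ≈⟨ ^order oᵍ ⟩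
      1#            ∎
    root-^r≈1 (suc i) = F*-^r≈1 (𝔽.nonzeroAt-nonzero i) (proj₂ (𝔽.nonzeroAt i))

  powerAut : ∀ t → IsUnitExponent t → FixingAut K F
  powerAut t a⊥N = record
    { σ      = λ (u , u≉0) → u ^ a , ^-nonzero a u≉0
    ; σ-cong = ^-congˡ a
    ; σ-hom  = λ (u , _) (v , _) _ w≈uv → trans (^-congˡ a w≈uv) (^-distrib-* u v a)
    ; σ-inj  = λ {(u , u≉0)} {(v , v≉0)} uᵃ≈vᵃ → trans (sym (undo u≉0)) (trans (^-congˡ b uᵃ≈vᵃ) (undo v≉0))
    ; σ-surj = λ (v , v≉0) → (v ^ b , ^-nonzero b v≉0) , redo v≉0
    ; σ-fix  = λ (u , u≉0) u∈F → fixed u≉0 u∈F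
    }
    where
    a : ℕ
    a = suc (r ℕ.* t)
    b : ℕ
    b = proj₁ (^-inverse a⊥N)
    undo : ∀ {z} → Nonzero z → (z ^ a) ^ b ≈ z
    undo = proj₂ (^-inverse a⊥N)
    redo : ∀ {z} → Nonzero z → (z ^ b) ^ a ≈ z
    redo {z} z≉0 = begin
      (z ^ b) ^ a   ≈⟨ ^-assocʳ z b a ⟩
      z ^ (b ℕ.* a) ≡⟨ ≡.cong (z ^_) (ℕ.*-comm b a) ⟩
      z ^ (a ℕ.* b) ≈⟨ ^-assocʳ z a b ⟨
      (z ^ a) ^ b   ≈⟨ undo z≉0 ⟩
      z             ∎
    fixed : ∀ {u} → Nonzero u → P u → u ^ a ≈ u
    fixed {u} u≉0 u∈F = begin
      u * u ^ (r ℕ.* t) ≈⟨ *-congˡ (^-assocʳ u r t) ⟨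
      u * (u ^ r) ^ t   ≈⟨ *-congˡ (^-congˡ t (F*-^r≈1 u≉0 u∈F)) ⟩
      u * 1# ^ t        ≈⟨ *-congˡ (1^n≈1 t) ⟩
      u * 1#            ≈⟨ *-identityʳ u ⟩
      u                 ∎

  open Setoid (FixingAutSetoid K F) using () renaming (_≈_ to _≈ᴬ_)

  module Classification (σA : FixingAut K F) where
    open FixingAut σA

    gᵘ : Units K
    gᵘ = g , g≉0

    σ1≈1 : proj₁ (σ (1# , 1≉0)) ≈ 1#
    σ1≈1 = sym (*-cancelˡ (proj₂ (σ (1# , 1≉0)))
      (trans (*-identityʳ _) (σ-hom (1# , 1≉0) (1# , 1≉0) (1# , 1≉0) (sym (*-identityʳ 1#)))))

    σ-^ : ∀ i → proj₁ (σ (g ^ i , ^-nonzero i g≉0)) ≈ proj₁ (σ gᵘ) ^ i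
    σ-^ zero    = σ1≈1
    σ-^ (suc i) = trans (σ-hom gᵘ (g ^ i , ^-nonzero i g≉0) (g ^ suc i , ^-nonzero (suc i) g≉0) refl) (*-congˡ (σ-^ i))

    a : ℕ
    a = proj₁ (discreteLog (proj₂ (σ gᵘ)))

    a<N : a < N
    a<N = proj₁ (proj₂ (discreteLog (proj₂ (σ gᵘ))))

    gᵃ≈σg : g ^ a ≈ proj₁ (σ gᵘ)
    gᵃ≈σg = proj₂ (proj₂ (discreteLog (proj₂ (σ gᵘ))))

    -- every u is a power of g, and σ g = gᵃ
    σ≈^a : ∀ u → proj₁ (σ u) ≈ proj₁ u ^ a
    σ≈^a (u , u≉0) with i , _ , gⁱ≈u ← discreteLog u≉0 = begin
      proj₁ (σ (u , u≉0))                 ≈⟨ σ-cong (sym gⁱ≈u) ⟩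
      proj₁ (σ (g ^ i , ^-nonzero i g≉0)) ≈⟨ σ-^ i ⟩
      proj₁ (σ gᵘ) ^ i                    ≈⟨ ^-congˡ i gᵃ≈σg ⟨
      (g ^ a) ^ i                         ≈⟨ ^-assocʳ g a i ⟩
      g ^ (a ℕ.* i)                       ≡⟨ ≡.cong (g ^_) (ℕ.*-comm a i) ⟩
      g ^ (i ℕ.* a)                       ≈⟨ ^-assocʳ g i a ⟨
      (g ^ i) ^ a                         ≈⟨ ^-congˡ a gⁱ≈u ⟩
      u ^ a                               ∎

    -- surjectivity: g = σ x = x^a = g^(i a), so N ∣ i a - 1
    a⊥N : Coprime a N
    a⊥N {d} (d∣a , d∣N)
      with (x , x≉0) , σx≈g ← σ-surj gᵘ
      with i , _ , gⁱ≈x ← discreteLog x≉0 =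
      ∣1⇒≡1 (∣m+n∣m⇒∣n (≡.subst (d ∣_) (≡.sym (ℕ.m∸n+n≡m 1≤ia)) (∣n⇒∣m*n i d∣a))
                       (∣-trans d∣N N∣ia∸1))
      where
      g¹≈gⁱᵃ : g ^ 1 ≈ g ^ (i ℕ.* a)
      g¹≈gⁱᵃ = begin
        g ^ 1               ≈⟨ *-identityʳ g ⟩
        g                   ≈⟨ σx≈g ⟨
        proj₁ (σ (x , x≉0)) ≈⟨ σ≈^a (x , x≉0) ⟩
        x ^ a               ≈⟨ ^-congˡ a gⁱ≈x ⟨
        (g ^ i) ^ a         ≈⟨ ^-assocʳ g i a ⟩
        g ^ (i ℕ.* a)       ∎
      1≤ia : 1 ≤ i ℕ.* a
      1≤ia = ℕ.n≢0⇒n>0 λ ia≡0 →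
        ℕ.<⇒≢ 1<N (≡.sym (∣1⇒≡1 (order∣ oᵍ (trans g¹≈gⁱᵃ (reflexive (≡.cong (g ^_) ia≡0))))))
      N∣ia∸1 : N ∣ i ℕ.* a ∸ 1
      N∣ia∸1 = order∣ oᵍ (^-∸≈1 g≉0 1≤ia g¹≈gⁱᵃ)

    1≤a : 1 ≤ a
    1≤a = ℕ.n≢0⇒n>0 λ a≡0 → ¬coprime-0 1<N (≡.subst (λ e → Coprime e N) a≡0 a⊥N)

    -- σ fixes g^L ∈ F, so g^L = g^(L a) and N = r L divides L (a - 1)
    r∣a∸1 : r ∣ a ∸ 1
    r∣a∸1 = *-cancelʳ-∣ L (≡.subst (N ∣_) La∸L≡[a∸1]L (order∣ oᵍ (^-∸≈1 g≉0 L≤La gᴸ≈gᴸᵃ)))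
      where
      gᴸ≈gᴸᵃ : g ^ L ≈ g ^ (L ℕ.* a)
      gᴸ≈gᴸᵃ = begin
        g ^ L                                ≈⟨ σ-fix (g ^ L , ^-nonzero L g≉0) g^L∈F ⟨
        proj₁ (σ (g ^ L , ^-nonzero L g≉0))  ≈⟨ σ≈^a (g ^ L , ^-nonzero L g≉0) ⟩
        (g ^ L) ^ a                          ≈⟨ ^-assocʳ g L a ⟩
        g ^ (L ℕ.* a)                        ∎
      L≤La : L ≤ L ℕ.* a
      L≤La = ℕ.m≤m*n L a {{ℕ.>-nonZero 1≤a}}
      La∸L≡[a∸1]L : L ℕ.* a ∸ L ≡ (a ∸ 1) ℕ.* L
      La∸L≡[a∸1]L = ≡.trans (≡.cong (L ℕ.* a ∸_) (≡.sym (ℕ.*-identityʳ L)))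
                      (≡.trans (≡.sym (ℕ.*-distribˡ-∸ L a 1)) (ℕ.*-comm L (a ∸ 1)))

    t : ℕ
    t = _∣_.quotient r∣a∸1

    a≡1+rt : a ≡ suc (r ℕ.* t)
    a≡1+rt = ≡.trans (≡.sym (ℕ.m∸n+n≡m 1≤a)) (≡.trans (ℕ.+-comm (a ∸ 1) 1)
               (≡.cong suc (≡.trans (_∣_.equality r∣a∸1) (ℕ.*-comm t r))))

    t<L : t < L
    t<L = ℕ.*-cancelˡ-< r t L (ℕ.<-trans (ℕ.n<1+n (r ℕ.* t)) (≡.subst (_< N) a≡1+rt a<N))

    t-isUnitExponent : IsUnitExponent t
    t-isUnitExponent = ≡.subst (λ e → Coprime e N) a≡1+rt a⊥N

    powerAut≈σ : powerAut t t-isUnitExponent ≈ᴬ σA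
    powerAut≈σ u = sym (≡.subst (λ e → proj₁ (σ u) ≈ proj₁ u ^ e) a≡1+rt (σ≈^a u))

  powerAut-cong : ∀ {t t′} (ok : IsUnitExponent t) (ok′ : IsUnitExponent t′) → t ≡ t′ →
                  powerAut t ok ≈ᴬ powerAut t′ ok′
  powerAut-cong _ _ ≡.refl _ = refl

  unitExponent-< : ∀ {t} → t < L → IsUnitExponent t → suc (r ℕ.* t) < N
  unitExponent-< {t} t<L a⊥N = ℕ.≤∧≢⇒< a≤N λ a≡N → ¬coprime-self 1<N (≡.subst (λ e → Coprime e N) a≡N a⊥N)
    where
    a≤N : suc (r ℕ.* t) ≤ N
    a≤N = ℕ.≤-trans (ℕ.+-monoˡ-≤ (r ℕ.* t) r>0) (≡.subst (_≤ N) (ℕ.*-suc r t) (ℕ.*-monoʳ-≤ r t<L))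

  automorphisms-cardinality : HasCardinality (FixingAutSetoid K F) (count unitExponent? L)
  automorphisms-cardinality = record
    { to        = aut
    ; cong      = λ { ≡.refl _ → refl }
    ; bijective = aut-injective , aut-surjective
    }
    where
    aut : Fin (count unitExponent? L) → FixingAut K F
    aut i = powerAut (nth unitExponent? L i) (nth-satisfies unitExponent? L i)
    exponent-< : ∀ i → suc (r ℕ.* nth unitExponent? L i) < N
    exponent-< i = unitExponent-< (nth-< unitExponent? L i) (nth-satisfies unitExponent? L i)
    aut-injective : ∀ {i j} → aut i ≈ᴬ aut j → i ≡ j
    aut-injective {i} {j} same = nth-injective unitExponent? L (ℕ.*-cancelˡ-≡ _ _ r {{ℕ.>-nonZero r>0}}
      (ℕ.suc-injective (^-injective g≉0 oᵍ (exponent-< i) (exponent-< j) (same (g , g≉0)))))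
    aut-surjective : ∀ σA → Σ (Fin (count unitExponent? L)) λ i → ∀ {j} → j ≡ i → aut j ≈ᴬ σA
    aut-surjective σA = i , λ { ≡.refl u →
      trans (powerAut-cong (nth-satisfies unitExponent? L i) t-isUnitExponent nthᵢ≡t u) (powerAut≈σ u) }
      where
      open Classification σA
      i : Fin (count unitExponent? L)
      i = proj₁ (nth-surjective unitExponent? L t<L t-isUnitExponent)
      nthᵢ≡t : nth unitExponent? L i ≡ t
      nthᵢ≡t = proj₂ (nth-surjective unitExponent? L t<L t-isUnitExponent)

open import Data.Nat using (ℕ; suc; _+_; _*_; _^_; _%_)
open import Data.Nat.Primality using (Prime)
open import Data.Product using (Σ; _×_)
open import Relation.Binary.PropositionalEquality using (_≡_)

open import Data.Nat.Base using (s≤s; z<s; nonTrivial⇒n>1)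
import Data.Nat.Properties as ℕ
open import Data.Nat.Primality using (prime⇒nonTrivial)
open import Data.Nat.Solver using (module +-*-Solver)
open import Data.Product using (_,_)
open import Relation.Binary.PropositionalEquality using (refl; subst; sym)
open Counting using (count)
open Totient using (module UnitExponents; count-unitExponents-q-odd; count-unitExponents-q-even)
open +-*-Solver

fixingAutomorphisms-count : ∀ q → 1 < q → (K : CommutativeRing 0ℓ 0ℓ) → IsField K →
  HasCardinality (CommutativeRing.setoid K) (q ^ 2) →
  (F : Subfield K) → HasCardinality (SubfieldSetoid K F) q →
  (q % 2 ≡ 1 → HasCardinality (FixingAutSetoid K F) (2 * φ (q + 1)))
  × (q % 2 ≡ 0 → HasCardinality (FixingAutSetoid K F) (φ (q + 1)))
fixingAutomorphisms-count (suc r) (s≤s r>0) K isField cardK F cardF =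
  (λ q-odd  → subst (HasCardinality (FixingAutSetoid K F)) (count-unitExponents-q-odd r q-odd) card) ,
  (λ q-even → subst (HasCardinality (FixingAutSetoid K F)) (count-unitExponents-q-even r q-even) card)
  where
  q²≡1+rL : suc r ^ 2 ≡ suc (r * (suc r + 1))
  q²≡1+rL = solve 1 (λ r → (con 1 :+ r) :^ 2 := con 1 :+ r :* (con 1 :+ r :+ con 1)) refl r
  card : HasCardinality (FixingAutSetoid K F) (count (UnitExponents.unitExponent? r) (suc r + 1))
  card = Automorphisms.automorphisms-cardinality K isField F r r>0
           (subst (HasCardinality (CommutativeRing.setoid K)) q²≡1+rL cardK) cardF

lemma4p2 : (q : ℕ) → Σ ℕ (λ p → Σ ℕ (λ k → Prime p × q ≡ p ^ suc k)) →
           (K : CommutativeRing 0ℓ 0ℓ) → IsField K →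
           HasCardinality (CommutativeRing.setoid K) (q ^ 2) →
           (F : Subfield K) → HasCardinality (SubfieldSetoid K F) q →
           (q % 2 ≡ 1 → HasCardinality (FixingAutSetoid K F) (2 * φ (q + 1)))
           × (q % 2 ≡ 0 → HasCardinality (FixingAutSetoid K F) (φ (q + 1)))
lemma4p2 q (p , k , pp , q≡pᵏ⁺¹) = fixingAutomorphisms-count q 1<q
  where
  1<q : 1 < q
  1<q = subst (1 <_) (sym q≡pᵏ⁺¹) (ℕ.^-monoʳ-< p (nonTrivial⇒n>1 p {{prime⇒nonTrivial pp}}) {0} {suc k} z<s)
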